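{- Let $S$ and $S'$ be disjoint finite sets such that $|S'|=\lceil\log_2(|S|+1)\rceil\geq 2$, i.e. $2^{|S'|-1}\leq|S|<2^{|S'|}$. Let $G$ be any graph with $V(G)=S\cup S'$ in which $S$ and $S'$ are stable sets. (1) If $2^{|S'|-1}<|S|<2^{|S'|}$, then $G$ is prime if and only if the map $s\mapsto N_G(s)$ is an injection from $S$ into $2^{S'}\setminus\{\emptyset\}$. (2) If $|S|=2^{|S'|-1}$, then $G$ is prime if and only if the map $s\mapsto N_G(s)$ is an injection from $S$ into $2^{S'}\setminus\{\emptyset\}$ and, for all $s\in S$ and $s'\in S'$, if $d_G(s)=d_G(s')=1$ then $s$ and $s'$ are not adjacent.
   Context: Graphs are simple and undirected. $N_G(v)$ is the set of neighbours of $v$ and $d_G(v)=|N_G(v)|$. A module of $G$ is a set $M\subseteq V(G)$ such that each vertex outside $M$ is adjacent to all or none of $M$; trivial modules are $\emptyset$, $V(G)$, singletons. $G$ is prime if $|V(G)|\geq 4$ and all its modules are trivial. -}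

module Defs where

open import Data.Nat using (ℕ; zero; suc; _+_; _≤_; _<_; _≥_; _∸_; _^_)
open import Data.Fin using (Fin)
import Data.Fin as F
open import Data.Bool using (Bool; true; false; if_then_else_)
open import Data.Sum using (_⊎_; inj₁; inj₂)
open import Data.Product using (Σ; _×_; ∃; ∃-syntax)
open import Relation.Binary.PropositionalEquality using (_≡_)
open import Relation.Nullary using (¬_)

record Graph (V : Set) : Set where
  field
    adj   : V → V → Bool
    sym   : ∀ u v → adj u v ≡ adj v u
    irrefl : ∀ v → adj v v ≡ false
open Graph public

Subset : Set → Set
Subset V = V → Bool

IsModule : {V : Set} → Graph V → Subset V → Set
IsModule {V} G M =
  ∀ x → M x ≡ false →
    (∀ y → M y ≡ true → adj G x y ≡ true) ⊎ (∀ y → M y ≡ true → adj G x y ≡ false)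

IsEmpty : {V : Set} → Subset V → Set
IsEmpty {V} M = ∀ v → M v ≡ false

IsFull : {V : Set} → Subset V → Set
IsFull {V} M = ∀ v → M v ≡ true

IsSingleton : {V : Set} → Subset V → Set
IsSingleton {V} M = Σ V λ u → M u ≡ true × (∀ v → M v ≡ true → v ≡ u)

IsTrivialModule : {V : Set} → Subset V → Set
IsTrivialModule M = IsEmpty M ⊎ IsFull M ⊎ IsSingleton M

countTrue : {n : ℕ} → (Fin n → Bool) → ℕ
countTrue {zero} f = 0
countTrue {suc n} f = (if f F.zero then 1 else 0) + countTrue (λ i → f (F.suc i))

-- Vertex set V(G) = S ∪ S' with S = Fin m (left), S' = Fin k (right), disjoint.
Vtx : ℕ → ℕ → Set
Vtx m k = Fin m ⊎ Fin k

IsPrime : {m k : ℕ} → Graph (Vtx m k) → Set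
IsPrime {m} {k} G = (m + k ≥ 4) × (∀ M → IsModule G M → IsTrivialModule M)

degree : {m k : ℕ} → Graph (Vtx m k) → Vtx m k → ℕ
degree G v = countTrue (λ i → adj G v (inj₁ i)) + countTrue (λ j → adj G v (inj₂ j))

Stable : {m k : ℕ} → Graph (Vtx m k) → Set
Stable {m} {k} G =
  (∀ (s t : Fin m) → adj G (inj₁ s) (inj₁ t) ≡ false) ×
  (∀ (s t : Fin k) → adj G (inj₂ s) (inj₂ t) ≡ false)

Nbh : {m k : ℕ} → Graph (Vtx m k) → Fin m → Subset (Fin k)
Nbh G s j = adj G (inj₁ s) (inj₂ j)

NbhInjNonempty : {m k : ℕ} → Graph (Vtx m k) → Set
NbhInjNonempty {m} {k} G =
  (∀ s → ∃[ j ] Nbh G s j ≡ true) ×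
  (∀ s t → (∀ j → Nbh G s j ≡ Nbh G t j) → s ≡ t)

NoDeg1Edge : {m k : ℕ} → Graph (Vtx m k) → Set
NoDeg1Edge {m} {k} G =
  ∀ (s : Fin m) (s' : Fin k) → degree G (inj₁ s) ≡ 1 → degree G (inj₂ s') ≡ 1 →
    adj G (inj₁ s) (inj₂ s') ≡ false

module Submission where

-- If G is prime, equal neighbourhoods of s ≠ t make {s, t} a module, an empty one makes
-- V ∖ {s} a module, and an edge ss' with d(s) = d(s') = 1 makes {s, s'} a module.
-- Conversely let M be a non-trivial module.  If M ⊆ S, its members have equal
-- neighbourhoods.  If M ⊆ S', two members are twins for all of S, so forgetting one of them
-- keeps the neighbourhoods distinct and nonempty and |S| < 2^(|S'|-1).  If M meets both S
-- and S', an outsider misses a member (by stability) hence all of M, so no edge leaves M and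
-- every N(s) is a nonempty subset of A = S' ∩ M or of B = S' ∖ M.  There are
-- (2^|A| - 1) + (2^|B| - 1) ≤ 2^(|S'|-1) such sets, with equality only if |A| = 1 or
-- |B| = 1; then |S| = 2^(|S'|-1) forces the singleton part {c} to be some N(s), and sc is
-- an edge with d(s) = d(c) = 1.

open import Defs hiding (sym)
open import Data.Nat using (ℕ; zero; suc; _+_; _≤_; _<_; _∸_; _^_; z≤n; s≤s)
import Data.Nat.Properties as ℕ
open import Data.Fin using (Fin; punchIn; punchOut; funToFin; finToFun)
import Data.Fin as F
open import Data.Fin.Properties using (any?; injective⇒≤; punchIn-punchOut; finToFun-funToFin; 2↔Bool)
open import Data.Fin.Instances
open import Data.Sum.Instances
open import Data.Bool using (Bool; true; false; not; _∨_; if_then_else_)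
open import Data.Bool.Instances
open import Data.Bool.Properties using (¬-not; not-injective)
open import Data.Sum using (_⊎_; inj₁; inj₂; [_,_])
open import Data.Sum.Properties using (inj₁-injective; inj₂-injective)
open import Data.Product using (_×_; _,_; ∃; proj₁; proj₂)
open import Data.Empty using (⊥-elim)
open import Data.Vec.Functional using (_∷_)
open import Function using (_∘_)
open import Function.Bundles using (_⇔_; mk⇔; Inverse)
open import Relation.Binary.PropositionalEquality
  using (_≡_; _≢_; refl; sym; trans; cong; cong₂; _≗_; ≢-sym; module ≡-Reasoning)
open import Relation.Binary.Structures using (IsDecEquivalence)
open import Relation.Binary.TypeClasses using (_≟_)
open import Relation.Nullary using (¬_; ¬?; yes; no; does; _×-dec_)
open import Relation.Nullary.Decidable using (dec-true; dec-false; decidable-stable)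

-- Subsets of finite types

≡true⇒≢false : ∀ {x} → x ≡ true → x ≢ false
≡true⇒≢false refl ()

Searchable : Set → Set
Searchable A = ∀ (P : A → Bool) b → (∃ λ x → P x ≡ b) ⊎ (∀ x → P x ≡ not b)

search-Fin : ∀ {n} → Searchable (Fin n)
search-Fin P b with any? (λ i → P i ≟ b)
... | yes found = inj₁ found
... | no none = inj₂ (λ i → ¬-not (λ p → none (i , p)))

otherMember? : ∀ {n} (X : Subset (Fin n)) (b : Bool) (a : Fin n) →
  (∃ λ j → X j ≡ b × j ≢ a) ⊎ (∀ j → X j ≡ b → j ≡ a)
otherMember? X b a with any? (λ j → (X j ≟ b) ×-dec ¬? (j ≟ a))
... | yes found = inj₁ found
... | no none = inj₂ (λ j Xj≡b → decidable-stable (j ≟ a) (λ j≢a → none (j , Xj≡b , j≢a)))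

search-⊎ : ∀ {A B} → Searchable A → Searchable B → Searchable (A ⊎ B)
search-⊎ searchA searchB P b with searchA (P ∘ inj₁) b | searchB (P ∘ inj₂) b
... | inj₁ (x , p) | _ = inj₁ (inj₁ x , p)
... | inj₂ _ | inj₁ (y , p) = inj₁ (inj₂ y , p)
... | inj₂ noA | inj₂ noB = inj₂ λ { (inj₁ x) → noA x ; (inj₂ y) → noB y }

_∪_ : ∀ {A} → Subset A → Subset A → Subset A
(X ∪ Y) x = X x ∨ Y x

module _ {A : Set} {{_ : IsDecEquivalence {A = A} _≡_}} where

  ⁅_⁆ : A → Subset A
  ⁅ x ⁆ y = does (y ≟ x)

  ∁⁅_⁆ : A → Subset A
  ∁⁅ x ⁆ y = not (does (y ≟ x))

  ⁅⁆-self : ∀ x → ⁅ x ⁆ x ≡ true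
  ⁅⁆-self x = dec-true (x ≟ x) refl

  ⁅⁆-other : ∀ {x y} → y ≢ x → ⁅ x ⁆ y ≡ false
  ⁅⁆-other {x} {y} = dec-false (y ≟ x)

  ⊆⁅⁆⇒≗ : ∀ {X : Subset A} {x} → X x ≡ true → (∀ y → X y ≡ true → y ≡ x) → X ≗ ⁅ x ⁆
  ⊆⁅⁆⇒≗ {X} {x} x∈ only y with y ≟ x
  ... | yes refl = x∈
  ... | no y≢x = ¬-not (λ y∈ → y≢x (only y y∈))

  ⁅⁆∪⁅⁆-left : ∀ x y → (⁅ x ⁆ ∪ ⁅ y ⁆) x ≡ true
  ⁅⁆∪⁅⁆-left x y rewrite ⁅⁆-self x = refl

  ⁅⁆∪⁅⁆-right : ∀ x y → (⁅ x ⁆ ∪ ⁅ y ⁆) y ≡ true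
  ⁅⁆∪⁅⁆-right x y with y ≟ x
  ... | yes _ = refl
  ... | no _ = ⁅⁆-self y

  ⁅⁆∪⁅⁆-∈ : ∀ {x y z} → (⁅ x ⁆ ∪ ⁅ y ⁆) z ≡ true → z ≡ x ⊎ z ≡ y
  ⁅⁆∪⁅⁆-∈ {x} {y} {z} z∈ with z ≟ x | z ≟ y
  ... | yes z≡x | _ = inj₁ z≡x
  ... | no _ | yes z≡y = inj₂ z≡y
  ⁅⁆∪⁅⁆-∈ () | no _ | no _

  ⁅⁆∪⁅⁆-∉ : ∀ {x y z} → (⁅ x ⁆ ∪ ⁅ y ⁆) z ≡ false → z ≢ x × z ≢ y
  ⁅⁆∪⁅⁆-∉ {x} {y} {z} z∉ with z ≟ x | z ≟ y
  ⁅⁆∪⁅⁆-∉ () | yes _ | _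
  ⁅⁆∪⁅⁆-∉ () | no _ | yes _
  ... | no z≢x | no z≢y = z≢x , z≢y

  ∁⁅⁆-self : ∀ x → ∁⁅ x ⁆ x ≡ false
  ∁⁅⁆-self x rewrite ⁅⁆-self x = refl

  ∁⁅⁆-other : ∀ {x y} → y ≢ x → ∁⁅ x ⁆ y ≡ true
  ∁⁅⁆-other y≢x rewrite ⁅⁆-other y≢x = refl

  ∁⁅⁆-∉ : ∀ {x y} → ∁⁅ x ⁆ y ≡ false → y ≡ x
  ∁⁅⁆-∉ {x} {y} y∉ = decidable-stable (y ≟ x) (λ y≢x → ≡true⇒≢false (∁⁅⁆-other y≢x) y∉)

countTrue-cong : ∀ {n} {X Y : Subset (Fin n)} → X ≗ Y → countTrue X ≡ countTrue Y
countTrue-cong {zero} X≗Y = refl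
countTrue-cong {suc n} X≗Y =
  cong₂ (λ b c → (if b then 1 else 0) + c) (X≗Y F.zero) (countTrue-cong (X≗Y ∘ F.suc))

countTrue-∅ : ∀ {n} {X : Subset (Fin n)} → (∀ i → X i ≡ false) → countTrue X ≡ 0
countTrue-∅ {zero} empty = refl
countTrue-∅ {suc n} empty rewrite empty F.zero = countTrue-∅ (empty ∘ F.suc)

countTrue-⁅⁆ : ∀ {n} (i : Fin n) → countTrue ⁅ i ⁆ ≡ 1
countTrue-⁅⁆ {suc n} F.zero = cong suc (countTrue-∅ {n} (λ _ → refl))
countTrue-⁅⁆ {suc n} (F.suc i) = countTrue-⁅⁆ i

countTrue≡0⇒∉ : ∀ {n} {X : Subset (Fin n)} → countTrue X ≡ 0 → ∀ i → X i ≡ false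
countTrue≡0⇒∉ {suc n} {X} c i with X F.zero in x₀
countTrue≡0⇒∉ {suc n} {X} c F.zero | false = x₀
countTrue≡0⇒∉ {suc n} {X} c (F.suc i) | false = countTrue≡0⇒∉ c i

countTrue≡1⇒≗⁅⁆ : ∀ {n} {X : Subset (Fin n)} {i} → countTrue X ≡ 1 → X i ≡ true → X ≗ ⁅ i ⁆
countTrue≡1⇒≗⁅⁆ {suc n} {X} {i} c i∈ with X F.zero in x₀
countTrue≡1⇒≗⁅⁆ {suc n} {X} {F.zero} c i∈ | true = λ where
  F.zero → x₀
  (F.suc j) → countTrue≡0⇒∉ (ℕ.suc-injective c) j
countTrue≡1⇒≗⁅⁆ {suc n} {X} {F.suc i} c i∈ | true =
  ⊥-elim (≡true⇒≢false i∈ (countTrue≡0⇒∉ (ℕ.suc-injective c) i))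
countTrue≡1⇒≗⁅⁆ {suc n} {X} {F.zero} c i∈ | false = ⊥-elim (≡true⇒≢false i∈ x₀)
countTrue≡1⇒≗⁅⁆ {suc n} {X} {F.suc i} c i∈ | false = λ where
  F.zero → x₀
  (F.suc j) → countTrue≡1⇒≗⁅⁆ c i∈ j

-- Injective families of subsets

InjectiveFamily : ∀ {m n} → (Fin m → Subset (Fin n)) → Set
InjectiveFamily f = ∀ s t → f s ≗ f t → s ≡ t

infix 4 _≗_except_
_≗_except_ : ∀ {n} → Subset (Fin n) → Subset (Fin n) → Fin n → Set
X ≗ Y except b = ∀ j → j ≢ b → X j ≡ Y j

subset→fin : ∀ {n} → Subset (Fin n) → Fin (2 ^ n)
subset→fin X = funToFin (Inverse.from 2↔Bool ∘ X)

subset→fin-injective : ∀ {n} {X Y : Subset (Fin n)} → subset→fin X ≡ subset→fin Y → X ≗ Y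
subset→fin-injective {X = X} {Y} eq j = begin
  X j                             ≡⟨ sym (strictlyInverseˡ (X j)) ⟩
  to (from (X j))                 ≡⟨ cong to (sym (finToFun-funToFin (from ∘ X) j)) ⟩
  to (finToFun (subset→fin X) j)  ≡⟨ cong (λ c → to (finToFun c j)) eq ⟩
  to (finToFun (subset→fin Y) j)  ≡⟨ cong to (finToFun-funToFin (from ∘ Y) j) ⟩
  to (from (Y j))                 ≡⟨ strictlyInverseˡ (Y j) ⟩
  Y j                             ∎
  where open ≡-Reasoning
        open Inverse 2↔Bool

injectiveFamily⇒≤ : ∀ {m n} {f : Fin m → Subset (Fin n)} → InjectiveFamily f → m ≤ 2 ^ n
injectiveFamily⇒≤ f-inj = injective⇒≤ (λ {s} {t} eq → f-inj s t (subset→fin-injective eq))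

injectiveFamily-missing⇒< : ∀ {m n} {f : Fin m → Subset (Fin n)} → InjectiveFamily f →
  (Z : Subset (Fin n)) → (∀ s → ¬ f s ≗ Z) → m < 2 ^ n
injectiveFamily-missing⇒< {f = f} f-inj Z missed = injectiveFamily⇒≤ {f = Z ∷ f} extended-inj
  where
  extended-inj : InjectiveFamily (Z ∷ f)
  extended-inj F.zero F.zero _ = refl
  extended-inj F.zero (F.suc t) eq = ⊥-elim (missed t (sym ∘ eq))
  extended-inj (F.suc s) F.zero eq = ⊥-elim (missed s eq)
  extended-inj (F.suc s) (F.suc t) eq = cong F.suc (f-inj s t eq)

≗∘punchIn⇒≗except : ∀ {n} {X Y : Subset (Fin (suc n))} {b} →
  X ∘ punchIn b ≗ Y ∘ punchIn b → X ≗ Y except b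
≗∘punchIn⇒≗except {X = X} {Y} eq j j≢b = begin
  X j                       ≡⟨ cong X (sym (punchIn-punchOut b≢j)) ⟩
  X (punchIn _ (punchOut b≢j)) ≡⟨ eq (punchOut b≢j) ⟩
  Y (punchIn _ (punchOut b≢j)) ≡⟨ cong Y (punchIn-punchOut b≢j) ⟩
  Y j                       ∎
  where open ≡-Reasoning
        b≢j = ≢-sym j≢b

injectiveExcept⇒≤ : ∀ {m n} {f : Fin m → Subset (Fin (suc n))} (b : Fin (suc n)) →
  (∀ s t → f s ≗ f t except b → s ≡ t) → m ≤ 2 ^ n
injectiveExcept⇒≤ b inj = injectiveFamily⇒≤ (λ s t eq → inj s t (≗∘punchIn⇒≗except eq))

injectiveExcept-missing⇒< : ∀ {m n} {f : Fin m → Subset (Fin (suc n))} (b : Fin (suc n)) →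
  (∀ s t → f s ≗ f t except b → s ≡ t) →
  (Z : Subset (Fin (suc n))) → (∀ s → ¬ f s ≗ Z except b) → m < 2 ^ n
injectiveExcept-missing⇒< b inj Z missed =
  injectiveFamily-missing⇒< (λ s t eq → inj s t (≗∘punchIn⇒≗except eq))
    (Z ∘ punchIn b) (λ s eq → missed s (≗∘punchIn⇒≗except eq))

duplicateCoordinate⇒< : ∀ {m n} {f : Fin m → Subset (Fin (suc n))} {a b} →
  InjectiveFamily f → (∀ s → ∃ λ j → f s j ≡ true) →
  a ≢ b → (∀ s → f s a ≡ f s b) → m < 2 ^ n
duplicateCoordinate⇒< {f = f} {a} {b} f-inj nonempty a≢b dup =
  injectiveExcept-missing⇒< b (λ s t eq → f-inj s t (restore eq)) (λ _ → false) missed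
  where
  restore : ∀ {s t} → f s ≗ f t except b → f s ≗ f t
  restore {s} {t} eq j with j ≟ b
  ... | yes refl = trans (sym (dup s)) (trans (eq a a≢b) (dup t))
  ... | no j≢b = eq j j≢b
  missed : ∀ s → ¬ f s ≗ (λ _ → false) except b
  missed s eq with nonempty s
  ... | j , j∈ with j ≟ b
  ...   | yes refl = ≡true⇒≢false (trans (dup s) j∈) (eq a a≢b)
  ...   | no j≢b = ≡true⇒≢false j∈ (eq j j≢b)

module SplitFamily {n : ℕ} (part : Subset (Fin (suc n)))
  {a₀ b₀ : Fin (suc n)} (a₀∈ : part a₀ ≡ true) (b₀∉ : part b₀ ≡ false) where

  Admissible : Bool → Subset (Fin (suc n)) → Set
  Admissible σ X = (∃ λ j → X j ≡ true) × (∀ j → X j ≡ true → part j ≡ σ)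

  private
    a₀≢b₀ : a₀ ≢ b₀
    a₀≢b₀ refl = ≡true⇒≢false a₀∈ b₀∉

    b₀∉X : ∀ {X} → Admissible true X → X b₀ ≡ false
    b₀∉X (_ , within) = ¬-not (λ b₀∈X → ≡true⇒≢false (within _ b₀∈X) b₀∉)

    a₀∉X : ∀ {X} → Admissible false X → X a₀ ≡ false
    a₀∉X (_ , within) = ¬-not (λ a₀∈X → ≡true⇒≢false a₀∈ (within _ a₀∈X))

  -- A set on the false side of part misses a₀, so coordinate a₀ can record whether it
  -- contains b₀; the codes then stay distinct after forgetting coordinate b₀.
  encode : Bool → Subset (Fin (suc n)) → Subset (Fin (suc n))
  encode true X = X
  encode false X j = if does (j ≟ a₀) then not (X b₀) else X j

  private
    encode-false-a₀ : ∀ X → encode false X a₀ ≡ not (X b₀)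
    encode-false-a₀ X rewrite dec-true (a₀ ≟ a₀) refl = refl

    encode-false-≢a₀ : ∀ X {j} → j ≢ a₀ → encode false X j ≡ X j
    encode-false-≢a₀ X {j} j≢a₀ rewrite dec-false (j ≟ a₀) j≢a₀ = refl

  encode-separates : ∀ {X Y} → Admissible true X → Admissible false Y →
    ¬ encode true X ≗ encode false Y except b₀
  encode-separates {X} {Y} ((i , i∈X) , X-within) ((j , j∈Y) , Y-within) eq with j ≟ b₀
  ... | no j≢b₀ = ≡true⇒≢false (X-within j j∈X) (Y-within j j∈Y)
    where
    j≢a₀ : j ≢ a₀
    j≢a₀ refl = ≡true⇒≢false a₀∈ (Y-within a₀ j∈Y)
    j∈X : X j ≡ true
    j∈X = trans (eq j j≢b₀) (trans (encode-false-≢a₀ Y j≢a₀) j∈Y)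
  ... | yes refl with i ≟ a₀
  ...   | yes refl =
    ≡true⇒≢false i∈X (trans (eq a₀ a₀≢b₀) (trans (encode-false-a₀ Y) (cong not j∈Y)))
  ...   | no i≢a₀ = ≡true⇒≢false (X-within i i∈X) (Y-within i i∈Y)
    where
    i≢b₀ : i ≢ b₀
    i≢b₀ refl = ≡true⇒≢false (X-within b₀ i∈X) b₀∉
    i∈Y : Y i ≡ true
    i∈Y = trans (sym (encode-false-≢a₀ Y i≢a₀)) (trans (sym (eq i i≢b₀)) i∈X)

  encode-injective : ∀ {σ τ X Y} → Admissible σ X → Admissible τ Y →
    encode σ X ≗ encode τ Y except b₀ → X ≗ Y
  encode-injective {true} {true} X-adm Y-adm eq j with j ≟ b₀
  ... | yes refl = trans (b₀∉X X-adm) (sym (b₀∉X Y-adm))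
  ... | no j≢b₀ = eq j j≢b₀
  encode-injective {false} {false} {X = X} {Y} X-adm Y-adm eq j with j ≟ b₀ | j ≟ a₀
  ... | yes refl | _ = not-injective (begin
    not (X b₀)          ≡⟨ sym (encode-false-a₀ X) ⟩
    encode false X a₀   ≡⟨ eq a₀ a₀≢b₀ ⟩
    encode false Y a₀   ≡⟨ encode-false-a₀ Y ⟩
    not (Y b₀)          ∎)
    where open ≡-Reasoning
  ... | no _ | yes refl = trans (a₀∉X X-adm) (sym (a₀∉X Y-adm))
  ... | no j≢b₀ | no j≢a₀ =
    trans (sym (encode-false-≢a₀ X j≢a₀)) (trans (eq j j≢b₀) (encode-false-≢a₀ Y j≢a₀))
  encode-injective {true} {false} X-adm Y-adm eq = ⊥-elim (encode-separates X-adm Y-adm eq)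
  encode-injective {false} {true} X-adm Y-adm eq =
    ⊥-elim (encode-separates Y-adm X-adm (λ j j≢b₀ → sym (eq j j≢b₀)))

  encode-avoids-⁅⁆∪⁅⁆ : ∀ {σ X a₁ b₁} → part a₁ ≡ true → a₁ ≢ a₀ → part b₁ ≡ false → b₁ ≢ b₀ →
    Admissible σ X → ¬ encode σ X ≗ ⁅ a₁ ⁆ ∪ ⁅ b₁ ⁆ except b₀
  encode-avoids-⁅⁆∪⁅⁆ {true} {a₁ = a₁} {b₁} _ _ b₁∉ b₁≢b₀ (_ , within) eq =
    ≡true⇒≢false (within b₁ (trans (eq b₁ b₁≢b₀) (⁅⁆∪⁅⁆-right a₁ b₁))) b₁∉
  encode-avoids-⁅⁆∪⁅⁆ {false} {X} {a₁} {b₁} a₁∈ a₁≢a₀ _ _ (_ , within) eq =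
    ≡true⇒≢false a₁∈ (within a₁ (trans (sym (encode-false-≢a₀ X a₁≢a₀))
                                  (trans (eq a₁ a₁≢b₀) (⁅⁆∪⁅⁆-left a₁ b₁))))
    where
    a₁≢b₀ : a₁ ≢ b₀
    a₁≢b₀ refl = ≡true⇒≢false a₁∈ b₀∉

  encode-preimage-⁅a₀⁆ : ∀ {σ X} → Admissible σ X → encode σ X ≗ ⁅ a₀ ⁆ except b₀ → X ≗ ⁅ a₀ ⁆
  encode-preimage-⁅a₀⁆ {true} X-adm eq j with j ≟ b₀
  ... | yes refl = trans (b₀∉X X-adm) (sym (⁅⁆-other (≢-sym a₀≢b₀)))
  ... | no j≢b₀ = eq j j≢b₀
  encode-preimage-⁅a₀⁆ {false} {X} ((j , j∈X) , within) eq with j ≟ b₀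
  ... | yes refl = ⊥-elim (≡true⇒≢false (⁅⁆-self a₀)
          (trans (sym (eq a₀ a₀≢b₀)) (trans (encode-false-a₀ X) (cong not j∈X))))
  ... | no j≢b₀ = ⊥-elim (≡true⇒≢false j∈X
          (trans (sym (encode-false-≢a₀ X j≢a₀)) (trans (eq j j≢b₀) (⁅⁆-other j≢a₀))))
    where
    j≢a₀ : j ≢ a₀
    j≢a₀ refl = ≡true⇒≢false a₀∈ (within a₀ j∈X)

  module _ {m} {f : Fin m → Subset (Fin (suc n))} {side : Fin m → Bool}
    (f-injective : InjectiveFamily f) (admissible : ∀ s → Admissible (side s) (f s)) where

    private
      code-injective : ∀ s t → encode (side s) (f s) ≗ encode (side t) (f t) except b₀ → s ≡ t
      code-injective s t eq = f-injective s t (encode-injective (admissible s) (admissible t) eq)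

    splitFamily⇒≤ : m ≤ 2 ^ n
    splitFamily⇒≤ = injectiveExcept⇒≤ b₀ code-injective

    splitFamily-⁅⁆∪⁅⁆⇒< : ∀ {a₁ b₁} → part a₁ ≡ true → a₁ ≢ a₀ → part b₁ ≡ false → b₁ ≢ b₀ →
      m < 2 ^ n
    splitFamily-⁅⁆∪⁅⁆⇒< a₁∈ a₁≢a₀ b₁∉ b₁≢b₀ =
      injectiveExcept-missing⇒< b₀ code-injective _
        (λ s → encode-avoids-⁅⁆∪⁅⁆ a₁∈ a₁≢a₀ b₁∉ b₁≢b₀ (admissible s))

    splitFamily-⁅a₀⁆∉⇒< : (∀ s → ¬ f s ≗ ⁅ a₀ ⁆) → m < 2 ^ n
    splitFamily-⁅a₀⁆∉⇒< missed =
      injectiveExcept-missing⇒< b₀ code-injective ⁅ a₀ ⁆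
        (λ s eq → missed s (encode-preimage-⁅a₀⁆ (admissible s) eq))

-- Modules

record Nontrivial {V : Set} (M : Subset V) : Set where
  field
    {outsider first second} : V
    outsider∉ : M outsider ≡ false
    first∈ : M first ≡ true
    second∈ : M second ≡ true
    first≢second : first ≢ second

nontrivial⇒¬trivial : ∀ {V} {M : Subset V} → Nontrivial M → ¬ IsTrivialModule M
nontrivial⇒¬trivial nt (inj₁ empty) = ≡true⇒≢false first∈ (empty first)
  where open Nontrivial nt
nontrivial⇒¬trivial nt (inj₂ (inj₁ full)) = ≡true⇒≢false (full outsider) outsider∉
  where open Nontrivial nt
nontrivial⇒¬trivial nt (inj₂ (inj₂ (_ , _ , only))) =
  first≢second (trans (only first first∈) (sym (only second second∈)))
  where open Nontrivial nt

¬nontrivial⇒trivial : ∀ {V} {{_ : IsDecEquivalence {A = V} _≡_}} → Searchable V →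
  (M : Subset V) → ¬ Nontrivial M → IsTrivialModule M
¬nontrivial⇒trivial search M ¬nt with search M true
... | inj₂ empty = inj₁ empty
... | inj₁ (y , y∈) with search M false
...   | inj₂ full = inj₂ (inj₁ full)
...   | inj₁ (o , o∉) = inj₂ (inj₂ (y , y∈ , λ x x∈ →
          decidable-stable (x ≟ y) (λ x≢y → ¬nt (record
            { outsider∉ = o∉ ; first∈ = x∈ ; second∈ = y∈ ; first≢second = x≢y }))))

module _ {V : Set} {{_ : IsDecEquivalence {A = V} _≡_}} where

  ⁅⁆∪⁅⁆-nontrivial : ∀ {u v w : V} → u ≢ v → w ≢ u → w ≢ v → Nontrivial (⁅ u ⁆ ∪ ⁅ v ⁆)
  ⁅⁆∪⁅⁆-nontrivial {u} {v} {w} u≢v w≢u w≢v = record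
    { outsider∉ = w∉ ; first∈ = ⁅⁆∪⁅⁆-left u v ; second∈ = ⁅⁆∪⁅⁆-right u v ; first≢second = u≢v }
    where
    w∉ : (⁅ u ⁆ ∪ ⁅ v ⁆) w ≡ false
    w∉ rewrite ⁅⁆-other w≢u | ⁅⁆-other w≢v = refl

  ∁⁅⁆-nontrivial : ∀ {u w₁ w₂ : V} → w₁ ≢ w₂ → w₁ ≢ u → w₂ ≢ u → Nontrivial ∁⁅ u ⁆
  ∁⁅⁆-nontrivial {u} w₁≢w₂ w₁≢u w₂≢u = record
    { outsider∉ = ∁⁅⁆-self u ; first∈ = ∁⁅⁆-other w₁≢u ; second∈ = ∁⁅⁆-other w₂≢u
    ; first≢second = w₁≢w₂ }

  module _ (G : Graph V) where

    ⁅⁆∪⁅⁆-isModule : ∀ {u v} → (∀ x → x ≢ u → x ≢ v → adj G x u ≡ adj G x v) →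
      IsModule G (⁅ u ⁆ ∪ ⁅ v ⁆)
    ⁅⁆∪⁅⁆-isModule {u} {v} alike x x∉ = uniformly (adj G x u) λ y y∈ → case y (⁅⁆∪⁅⁆-∈ y∈)
      where
      case : ∀ y → y ≡ u ⊎ y ≡ v → adj G x y ≡ adj G x u
      case y (inj₁ refl) = refl
      case y (inj₂ refl) = sym (alike x (proj₁ (⁅⁆∪⁅⁆-∉ x∉)) (proj₂ (⁅⁆∪⁅⁆-∉ x∉)))
      uniformly : ∀ b → (∀ y → (⁅ u ⁆ ∪ ⁅ v ⁆) y ≡ true → adj G x y ≡ b) →
        (∀ y → (⁅ u ⁆ ∪ ⁅ v ⁆) y ≡ true → adj G x y ≡ true) ⊎
        (∀ y → (⁅ u ⁆ ∪ ⁅ v ⁆) y ≡ true → adj G x y ≡ false)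
      uniformly true = inj₁
      uniformly false = inj₂

    ∁⁅⁆-isModule : ∀ {u} → (∀ y → adj G u y ≡ false) → IsModule G ∁⁅ u ⁆
    ∁⁅⁆-isModule {u} isolated x x∉ with ∁⁅⁆-∉ {x = u} {y = x} x∉
    ... | refl = inj₂ (λ y _ → isolated y)

isModule-alike : ∀ {V} (G : Graph V) {M x y z} → IsModule G M →
  M x ≡ false → M y ≡ true → M z ≡ true → adj G x y ≡ adj G x z
isModule-alike G mod x∉ y∈ z∈ with mod _ x∉
... | inj₁ all = trans (all _ y∈) (sym (all _ z∈))
... | inj₂ none = trans (none _ y∈) (sym (none _ z∈))

-- Stable bipartite graphs

search-Vtx : ∀ {m k} → Searchable (Vtx m k)
search-Vtx = search-⊎ search-Fin search-Fin

another : ∀ {n} (c : Fin (suc (suc n))) → ∃ λ d → d ≢ c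
another F.zero = F.suc F.zero , λ ()
another (F.suc c) = F.zero , λ ()

module Bipartite {m n : ℕ} (G : Graph (Vtx m (suc (suc n)))) (stable : Stable G) where

  degree-left : ∀ s → degree G (inj₁ s) ≡ countTrue (Nbh G s)
  degree-left s = cong (_+ countTrue (Nbh G s)) (countTrue-∅ (proj₁ stable s))

  degree-right : ∀ c → degree G (inj₂ c) ≡ countTrue (λ s → Nbh G s c)
  degree-right c = begin
    countTrue (λ s → adj G (inj₂ c) (inj₁ s)) + countTrue (λ j → adj G (inj₂ c) (inj₂ j))
      ≡⟨ cong₂ _+_ (countTrue-cong (λ s → Graph.sym G (inj₂ c) (inj₁ s)))
                   (countTrue-∅ (proj₂ stable c)) ⟩
    countTrue (λ s → Nbh G s c) + 0
      ≡⟨ ℕ.+-identityʳ _ ⟩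
    countTrue (λ s → Nbh G s c) ∎
    where open ≡-Reasoning

  prime⇒¬nontrivial : ∀ {M} → IsPrime G → IsModule G M → ¬ Nontrivial M
  prime⇒¬nontrivial (_ , trivial) mod nt = nontrivial⇒¬trivial nt (trivial _ mod)

  prime⇒nonempty : IsPrime G → ∀ s → ∃ λ j → Nbh G s j ≡ true
  prime⇒nonempty prime s with search-Fin (Nbh G s) true
  ... | inj₁ found = found
  ... | inj₂ empty = ⊥-elim (prime⇒¬nontrivial prime (∁⁅⁆-isModule G isolated)
          (∁⁅⁆-nontrivial {w₁ = inj₂ F.zero} {inj₂ (F.suc F.zero)} (λ ()) (λ ()) (λ ())))
    where
    isolated : ∀ y → adj G (inj₁ s) y ≡ false
    isolated (inj₁ t) = proj₁ stable s t
    isolated (inj₂ j) = empty j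

  prime⇒injective : IsPrime G → InjectiveFamily (Nbh G)
  prime⇒injective prime s t same = decidable-stable (s ≟ t) λ s≢t →
    prime⇒¬nontrivial prime (⁅⁆∪⁅⁆-isModule G alike)
      (⁅⁆∪⁅⁆-nontrivial {w = inj₂ F.zero} (s≢t ∘ inj₁-injective) (λ ()) (λ ()))
    where
    alike : ∀ x → x ≢ inj₁ s → x ≢ inj₁ t → adj G x (inj₁ s) ≡ adj G x (inj₁ t)
    alike (inj₁ u) _ _ = trans (proj₁ stable u s) (sym (proj₁ stable u t))
    alike (inj₂ j) _ _ = begin
      adj G (inj₂ j) (inj₁ s)  ≡⟨ Graph.sym G (inj₂ j) (inj₁ s) ⟩
      Nbh G s j                ≡⟨ same j ⟩
      Nbh G t j                ≡⟨ Graph.sym G (inj₁ t) (inj₂ j) ⟩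
      adj G (inj₂ j) (inj₁ t)  ∎
      where open ≡-Reasoning

  prime⇒noDeg1Edge : IsPrime G → NoDeg1Edge G
  prime⇒noDeg1Edge prime s c deg-s deg-c = ¬-not λ s~c →
    prime⇒¬nontrivial prime (⁅⁆∪⁅⁆-isModule G (alike s~c))
      (⁅⁆∪⁅⁆-nontrivial {w = inj₂ (proj₁ (another c))} (λ ()) (λ ())
        (proj₂ (another c) ∘ inj₂-injective))
    where
    alike : Nbh G s c ≡ true →
      ∀ x → x ≢ inj₁ s → x ≢ inj₂ c → adj G x (inj₁ s) ≡ adj G x (inj₂ c)
    alike s~c (inj₁ t) t≢s _ = trans (proj₁ stable t s) (sym (begin
      Nbh G t c  ≡⟨ countTrue≡1⇒≗⁅⁆ (trans (sym (degree-right c)) deg-c) s~c t ⟩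
      ⁅ s ⁆ t    ≡⟨ ⁅⁆-other (t≢s ∘ cong inj₁) ⟩
      false      ∎))
      where open ≡-Reasoning
    alike s~c (inj₂ j) _ j≢c = trans (begin
      adj G (inj₂ j) (inj₁ s)  ≡⟨ Graph.sym G (inj₂ j) (inj₁ s) ⟩
      Nbh G s j                ≡⟨ countTrue≡1⇒≗⁅⁆ (trans (sym (degree-left s)) deg-s) s~c j ⟩
      ⁅ c ⁆ j                  ≡⟨ ⁅⁆-other (j≢c ∘ cong inj₂) ⟩
      false                    ∎) (sym (proj₂ stable j c))
      where open ≡-Reasoning

  mixedModule-outsiderNonadjacent : ∀ {M s₀ a₀ x y} → IsModule G M →
    M (inj₁ s₀) ≡ true → M (inj₂ a₀) ≡ true → M x ≡ false → M y ≡ true → adj G x y ≡ false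
  mixedModule-outsiderNonadjacent {x = inj₁ u} mod s₀∈ _ u∉ y∈ =
    trans (isModule-alike G mod u∉ y∈ s₀∈) (proj₁ stable u _)
  mixedModule-outsiderNonadjacent {x = inj₂ j} mod _ a₀∈ j∉ y∈ =
    trans (isModule-alike G mod j∉ y∈ a₀∈) (proj₂ stable j _)

  module Sufficiency (H : NbhInjNonempty G) (lower : 2 ^ suc n ≤ m) where

    private
      nonempty = proj₁ H
      injective = proj₂ H

    noDeg1Edge⇒¬pendant : NoDeg1Edge G → ∀ {s c} → Nbh G s ≗ ⁅ c ⁆ →
      ¬ (∀ t → Nbh G t c ≡ true → ∀ j → Nbh G t j ≡ true → j ≡ c)
    noDeg1Edge⇒¬pendant noDeg1 {s} {c} s-nbh c-pendant =
      ≡true⇒≢false s~c (noDeg1 s c deg-s deg-c)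
      where
      s~c : Nbh G s c ≡ true
      s~c = trans (s-nbh c) (⁅⁆-self c)
      c-nbh : (λ t → Nbh G t c) ≗ ⁅ s ⁆
      c-nbh = ⊆⁅⁆⇒≗ s~c (λ t t~c →
        injective t s (λ j → trans (⊆⁅⁆⇒≗ t~c (c-pendant t t~c) j) (sym (s-nbh j))))
      deg-s : degree G (inj₁ s) ≡ 1
      deg-s = trans (degree-left s) (trans (countTrue-cong s-nbh) (countTrue-⁅⁆ c))
      deg-c : degree G (inj₂ c) ≡ 1
      deg-c = trans (degree-right c) (trans (countTrue-cong c-nbh) (countTrue-⁅⁆ s))

    leftModule-subsingleton : ∀ {M} → IsModule G M → (∀ c → M (inj₂ c) ≡ false) →
      ∀ {x y} → M x ≡ true → M y ≡ true → x ≡ y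
    leftModule-subsingleton mod noRight {inj₂ a} a∈ _ = ⊥-elim (≡true⇒≢false a∈ (noRight a))
    leftModule-subsingleton mod noRight {_} {inj₂ b} _ b∈ = ⊥-elim (≡true⇒≢false b∈ (noRight b))
    leftModule-subsingleton mod noRight {inj₁ s} {inj₁ t} s∈ t∈ = cong inj₁ (injective s t λ j →
      begin
        Nbh G s j                ≡⟨ Graph.sym G (inj₁ s) (inj₂ j) ⟩
        adj G (inj₂ j) (inj₁ s)  ≡⟨ isModule-alike G mod (noRight j) s∈ t∈ ⟩
        adj G (inj₂ j) (inj₁ t)  ≡⟨ Graph.sym G (inj₂ j) (inj₁ t) ⟩
        Nbh G t j                ∎)
      where open ≡-Reasoning

    rightModule-subsingleton : ∀ {M} → IsModule G M → (∀ s → M (inj₁ s) ≡ false) →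
      ∀ {x y} → M x ≡ true → M y ≡ true → x ≡ y
    rightModule-subsingleton mod noLeft {inj₁ s} s∈ _ = ⊥-elim (≡true⇒≢false s∈ (noLeft s))
    rightModule-subsingleton mod noLeft {_} {inj₁ t} _ t∈ = ⊥-elim (≡true⇒≢false t∈ (noLeft t))
    rightModule-subsingleton mod noLeft {inj₂ a} {inj₂ b} a∈ b∈ =
      cong inj₂ (decidable-stable (a ≟ b) λ a≢b →
        ℕ.<⇒≱ (duplicateCoordinate⇒< injective nonempty a≢b
                 (λ s → isModule-alike G mod (noLeft s) a∈ b∈)) lower)

    mixedModule-rightOutsider : ∀ {M s₀ a₀ o} → IsModule G M →
      M (inj₁ s₀) ≡ true → M (inj₂ a₀) ≡ true → M o ≡ false → ∃ λ b₀ → M (inj₂ b₀) ≡ false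
    mixedModule-rightOutsider {M} {o = o} mod s₀∈ a₀∈ o∉ with search-Fin (M ∘ inj₂) false | o
    ... | inj₁ found | _ = found
    ... | inj₂ allRight | inj₂ j = ⊥-elim (≡true⇒≢false (allRight j) o∉)
    ... | inj₂ allRight | inj₁ u = ⊥-elim (≡true⇒≢false u~j
            (mixedModule-outsiderNonadjacent mod s₀∈ a₀∈ o∉ (allRight j)))
      where
      j = proj₁ (nonempty u)
      u~j = proj₂ (nonempty u)

    module MixedModule {M} (mod : IsModule G M) {s₀ a₀ b₀}
      (s₀∈ : M (inj₁ s₀) ≡ true) (a₀∈ : M (inj₂ a₀) ≡ true) (b₀∉ : M (inj₂ b₀) ≡ false) where

      Nbh-sameSide : ∀ s j → Nbh G s j ≡ true → M (inj₂ j) ≡ M (inj₁ s)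
      Nbh-sameSide s j s~j with M (inj₁ s) in s? | M (inj₂ j) in j?
      ... | true | true = refl
      ... | false | false = refl
      ... | true | false = ⊥-elim (≡true⇒≢false s~j (trans (Graph.sym G (inj₁ s) (inj₂ j))
              (mixedModule-outsiderNonadjacent mod s₀∈ a₀∈ j? s?)))
      ... | false | true = ⊥-elim (≡true⇒≢false s~j
              (mixedModule-outsiderNonadjacent mod s₀∈ a₀∈ s? j?))

      soleInSide⇒unused : NoDeg1Edge G → ∀ {c} → (∀ j → M (inj₂ j) ≡ M (inj₂ c) → j ≡ c) →
        ∀ s → ¬ Nbh G s ≗ ⁅ c ⁆
      soleInSide⇒unused noDeg1 {c} sole s s-nbh = noDeg1Edge⇒¬pendant noDeg1 s-nbh
        λ t t~c j t~j → sole j (trans (Nbh-sameSide t j t~j) (sym (Nbh-sameSide t c t~c)))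

      module Split = SplitFamily (M ∘ inj₂) a₀∈ b₀∉
      module SplitSwapped = SplitFamily (not ∘ M ∘ inj₂) (cong not b₀∉) (cong not a₀∈)

      bound : m ≤ 2 ^ suc n
      bound = Split.splitFamily⇒≤ injective (λ s → nonempty s , Nbh-sameSide s)

      strictBound : NoDeg1Edge G → m < 2 ^ suc n
      strictBound noDeg1 with otherMember? (M ∘ inj₂) true a₀ | otherMember? (M ∘ inj₂) false b₀
      ... | inj₁ (a₁ , a₁∈ , a₁≢a₀) | inj₁ (b₁ , b₁∉ , b₁≢b₀) =
        Split.splitFamily-⁅⁆∪⁅⁆⇒< injective (λ s → nonempty s , Nbh-sameSide s)
          a₁∈ a₁≢a₀ b₁∉ b₁≢b₀
      ... | inj₂ onlyA | _ =
        Split.splitFamily-⁅a₀⁆∉⇒< injective (λ s → nonempty s , Nbh-sameSide s)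
          (soleInSide⇒unused noDeg1 (λ j eq → onlyA j (trans eq a₀∈)))
      ... | _ | inj₂ onlyB =
        SplitSwapped.splitFamily-⁅a₀⁆∉⇒< injective
          (λ s → nonempty s , λ j s~j → cong not (Nbh-sameSide s j s~j))
          (soleInSide⇒unused noDeg1 (λ j eq → onlyB j (trans eq b₀∉)))

    ¬nontrivialModule : 2 ^ suc n < m ⊎ NoDeg1Edge G → ∀ {M} → IsModule G M → ¬ Nontrivial M
    ¬nontrivialModule extra {M} mod nt with search-Fin (M ∘ inj₁) true | search-Fin (M ∘ inj₂) true
    ... | inj₂ noLeft | _ = first≢second (rightModule-subsingleton mod noLeft first∈ second∈)
      where open Nontrivial nt
    ... | _ | inj₂ noRight = first≢second (leftModule-subsingleton mod noRight first∈ second∈)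
      where open Nontrivial nt
    ... | inj₁ (s₀ , s₀∈) | inj₁ (a₀ , a₀∈)
      with mixedModule-rightOutsider mod s₀∈ a₀∈ (Nontrivial.outsider∉ nt)
    ...   | b₀ , b₀∉ = [ (λ m> → ℕ.<⇒≱ m> bound) , (λ noDeg1 → ℕ.<⇒≱ (strictBound noDeg1) lower) ] extra
      where open MixedModule mod s₀∈ a₀∈ b₀∉

    nbhInjNonempty⇒prime : 2 ^ suc n < m ⊎ NoDeg1Edge G → IsPrime G
    nbhInjNonempty⇒prime extra = size , λ M mod → ¬nontrivial⇒trivial search-Vtx M (¬nontrivialModule extra mod)
      where
      size : 4 ≤ m + suc (suc n)
      size = ℕ.+-mono-≤ (ℕ.≤-trans (ℕ.*-monoʳ-≤ 2 (ℕ.m^n>0 2 n)) lower) (s≤s (s≤s z≤n))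

lemma21 : (m k : ℕ) → 2 ≤ k → 2 ^ (k ∸ 1) ≤ m → m < 2 ^ k →
    (G : Graph (Vtx m k)) → Stable G →
    ((2 ^ (k ∸ 1) < m → (IsPrime G ⇔ NbhInjNonempty G)) ×
    (m ≡ 2 ^ (k ∸ 1) → (IsPrime G ⇔ (NbhInjNonempty G × NoDeg1Edge G))))
lemma21 m (suc (suc n)) (s≤s (s≤s z≤n)) lower _ G stable =
    (λ m> → mk⇔ necessary (λ H → Sufficiency.nbhInjNonempty⇒prime H lower (inj₁ m>)))
  , (λ _ → mk⇔ (λ prime → necessary prime , prime⇒noDeg1Edge prime)
               (λ (H , noDeg1) → Sufficiency.nbhInjNonempty⇒prime H lower (inj₂ noDeg1)))
  where
  open Bipartite G stable
  necessary : IsPrime G → NbhInjNonempty G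
  necessary prime = prime⇒nonempty prime , prime⇒injective prime
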